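{- Let $k,\ell,b,n_1,n_2$ be positive integers with $k,\ell\leq b$, $2(k+b)<n_1$, $2(\ell+b)<n_2$. Let $\mathcal{R}$ be a proj-intersecting family of $k\times\ell$ rectangles in $\mathbb{Z}_{n_1}\times\mathbb{Z}_{n_2}$. Then at least one of the following holds: $|\mathcal{R}|<9b^2$; $|\mathcal{R}|\leq 4b^2+(\ell-1)n_1$; $|\mathcal{R}|\leq \ell n_1$; $|\mathcal{R}|\leq 4b^2+(k-1)n_2$; $|\mathcal{R}|\leq k n_2$.
   Context: An interval of length $a$ in $\mathbb{Z}_n$ is a set $\{i+1,\ldots,i+a\}$ (mod $n$). A $k\times\ell$ rectangle in $\mathbb{Z}_{n_1}\times\mathbb{Z}_{n_2}$ is $I\times J$ with $I$ an interval of length $k$ in $\mathbb{Z}_{n_1}$ and $J$ an interval of length $\ell$ in $\mathbb{Z}_{n_2}$. Rectangles $I\times J$, $I'\times J'$ are proj-intersecting if $I\cap I'\neq\emptyset$ or $J\cap J'\neq\emptyset$; a family is proj-intersecting if every two members are. -}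

module Defs where

open import Data.Nat using (ℕ; suc; _+_; _<_; NonZero)
open import Data.Nat.DivMod using (_%_)
open import Data.Fin using (Fin; toℕ)
open import Data.Product using (Σ; ∃; _×_; _,_)
open import Data.Sum using (_⊎_)
open import Data.List using (List)
open import Data.List.Membership.Propositional using (_∈_)
open import Relation.Binary.PropositionalEquality using (_≡_)

InInterval : (n : ℕ) → .{{NonZero n}} → (i a : ℕ) → Fin n → Set
InInterval n i a x = Σ ℕ λ t → t < a × toℕ x ≡ (i + suc t) % n

IntervalsMeet : (n : ℕ) → .{{NonZero n}} → (i i' a : ℕ) → Set
IntervalsMeet n i i' a = ∃ λ (x : Fin n) → InInterval n i a x × InInterval n i' a x

-- A k×ℓ rectangle in Z_{n1}×Z_{n2} is I×J with I = {i+1,…,i+k}, J = {j+1,…,j+ℓ};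
-- it is represented by its parameter pair (i , j) ∈ Z_{n1} × Z_{n2}.
Rect : ℕ → ℕ → Set
Rect n₁ n₂ = Fin n₁ × Fin n₂

ProjIntersecting : (n₁ n₂ : ℕ) → .{{NonZero n₁}} → .{{NonZero n₂}} → (k ℓ : ℕ) →
                   Rect n₁ n₂ → Rect n₁ n₂ → Set
ProjIntersecting n₁ n₂ k ℓ (i , j) (i' , j') =
  IntervalsMeet n₁ (toℕ i) (toℕ i') k ⊎ IntervalsMeet n₂ (toℕ j) (toℕ j') ℓ

ProjIntersectingFamily : (n₁ n₂ : ℕ) → .{{NonZero n₁}} → .{{NonZero n₂}} → (k ℓ : ℕ) →
                         List (Rect n₁ n₂) → Set
ProjIntersectingFamily n₁ n₂ k ℓ R =
  ∀ {r s} → r ∈ R → s ∈ R → ProjIntersecting n₁ n₂ k ℓ r s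

module Submission where

-- Call x, y ∈ ℤ_n near when the intervals of length a following them meet.  Each point is near
-- 2a − 1 points; for near c, c′ at most a − 1 points are near c′ but far from c, for far c, c′ at
-- most a − 1 points are near both, and pairwise near points number at most a.
-- If some column holds more than ℓ rectangles, two of them have far rows, so a rectangle whose
-- column is far from theirs, i₀, has its row among a − 1 rows; otherwise |R| ≤ ℓ n₁.  Likewise
-- with rows and columns exchanged, giving a row j₀.  Counting rectangles by whether their column
-- is near i₀ and their row near j₀ gives |R| ≤ (ℓ − 1) n₁ + (2k − 1)(2ℓ − 1), unless more than
-- (2k − 1)(ℓ − 1) have column near i₀ and row far from j₀; then ℓ of them share a column i₁ near
-- i₀.  Symmetrically k rectangles with row near j₀ and column far from i₀ share a row j₁ near j₀.
-- At most ℓ − 1 of the former have rows near j₁, so one, x, has its row far from j₁; likewise one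
-- of the latter, y, has its column far from i₁, and x, y do not proj-intersect.

open import Data.Empty using (⊥; ⊥-elim)
open import Data.Fin using (Fin; toℕ)
open import Data.Fin.Properties using (toℕ<n; toℕ-injective) renaming (_≟_ to _≟ᶠ_)
open import Data.List using (List; []; _∷_; length; map; _++_; filter; allFin; applyUpTo; cartesianProduct)
open import Data.List.Membership.Propositional using (_∈_; find)
open import Data.List.Membership.Propositional.Properties
  using (∈-++⁺ˡ; ∈-++⁺ʳ; ∈-filter⁺; ∈-filter⁻; ∈-allFin; ∈-applyUpTo⁺; ∈-cartesianProduct⁺)
open import Data.List.Properties using (length-map; length-++; length-applyUpTo; length-tabulate)
open import Data.List.Relation.Unary.All as All using (all?)
open import Data.List.Relation.Unary.All.Properties using (¬All⇒Any¬)
open import Data.List.Relation.Unary.Any using (here; there)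
open import Data.List.Relation.Unary.AllPairs using (_∷_)
open import Data.List.Relation.Unary.Unique.Propositional using (Unique)
import Data.List.Relation.Unary.Unique.Propositional.Properties as Unique
open import Data.Nat using (ℕ; zero; suc; _+_; _*_; _∸_; _<_; _≤_; NonZero; z≤n; s≤s; _≤?_; _<?_)
open import Data.Nat.DivMod using (_%_; m<n⇒m%n≡m; [m+n]%n≡m%n)
open import Data.Nat.Properties
open import Data.Nat.Tactic.RingSolver using (solve-∀; solve)
open import Data.Product using (Σ; ∃; ∃₂; _×_; _,_; proj₁; proj₂; uncurry)
open import Data.Sum using (_⊎_; inj₁; inj₂; swap)
open import Data.Unit using (⊤; tt)
open import Function using (id)
open import Level using (0ℓ)
open import Relation.Binary.Definitions using (DecidableEquality) renaming (Decidable to Decidable₂)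
open import Relation.Binary.PropositionalEquality
open import Relation.Nullary using (¬_; yes; no; Dec; _×-dec_; _⊎-dec_)
open import Relation.Unary using (Pred; Decidable)
open import Relation.Unary.Properties using (∁?)

open import Defs

module _ {A : Set} where

  remove : {x : A} (xs : List A) → x ∈ xs → List A
  remove (_ ∷ xs) (here _)  = xs
  remove (y ∷ xs) (there p) = y ∷ remove xs p

  length-remove : ∀ {x} (xs : List A) (p : x ∈ xs) → suc (length (remove xs p)) ≡ length xs
  length-remove (_ ∷ xs) (here _)  = refl
  length-remove (_ ∷ xs) (there p) = cong suc (length-remove xs p)

  ∈-remove : ∀ {x y} (xs : List A) (p : x ∈ xs) → y ∈ xs → y ≢ x → y ∈ remove xs p
  ∈-remove (_ ∷ xs) (here refl) (here refl) y≢x = ⊥-elim (y≢x refl)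
  ∈-remove (_ ∷ xs) (here refl) (there q)   _   = q
  ∈-remove (_ ∷ xs) (there p)   (here refl) _   = here refl
  ∈-remove (_ ∷ xs) (there p)   (there q)   y≢x = there (∈-remove xs p q y≢x)

  allPairs-or-counterexample : {R : A → A → Set} → Decidable₂ R → (xs : List A) →
    (∀ {x y} → x ∈ xs → y ∈ xs → R x y) ⊎ ∃₂ λ x y → x ∈ xs × y ∈ xs × ¬ R x y
  allPairs-or-counterexample {R} R? xs with all? (λ x → all? (R? x) xs) xs
  ... | yes allR = inj₁ λ x∈ y∈ → All.lookup (All.lookup allR x∈) y∈
  ... | no ¬allR with find (¬All⇒Any¬ (λ x → all? (R? x) xs) xs ¬allR)
  ...   | x , x∈ , ¬allRx with find (¬All⇒Any¬ (R? x) xs ¬allRx)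
  ...     | y , y∈ , ¬Rxy = inj₂ (x , y , x∈ , y∈ , ¬Rxy)

length-filter+filter-∁ : {A : Set} {P : Pred A 0ℓ} (P? : Decidable P) (xs : List A) →
  length xs ≡ length (filter P? xs) + length (filter (∁? P?) xs)
length-filter+filter-∁ P? [] = refl
length-filter+filter-∁ P? (x ∷ xs) with P? x
... | yes _ = cong suc (length-filter+filter-∁ P? xs)
... | no  _ = trans (cong suc (length-filter+filter-∁ P? xs)) (sym (+-suc _ _))

InjectiveOn : {A B : Set} → List A → (A → B) → Set
InjectiveOn xs f = ∀ {x y} → x ∈ xs → y ∈ xs → f x ≡ f y → x ≡ y

length-≤-injection : {A B : Set} (f : A → B) {xs : List A} {ys : List B} → Unique xs →
  InjectiveOn xs f → (∀ {x} → x ∈ xs → f x ∈ ys) → length xs ≤ length ys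
length-≤-injection f {[]}     _          _     _   = z≤n
length-≤-injection f {x ∷ xs} {ys} (x∉xs ∷ uniq) f-inj f∈ys =
  subst (suc (length xs) ≤_) (length-remove ys fx∈ys)
        (s≤s (length-≤-injection f uniq (λ p q → f-inj (there p) (there q)) f∈rest))
  where
  fx∈ys = f∈ys (here refl)
  f∈rest : ∀ {y} → y ∈ xs → f y ∈ remove ys fx∈ys
  f∈rest y∈xs = ∈-remove ys fx∈ys (f∈ys (there y∈xs))
    (λ fy≡fx → All.lookup x∉xs y∈xs (sym (f-inj (there y∈xs) (here refl) fy≡fx)))

AtMost : {A : Set} → ℕ → Pred A 0ℓ → Set
AtMost {A} m P = Σ (List A) λ L → length L ≤ m × (∀ {x} → P x → x ∈ L)

atMost-weaken : {A : Set} {P : Pred A 0ℓ} {m m′ : ℕ} → m ≤ m′ → AtMost m P → AtMost m′ P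
atMost-weaken m≤m′ (L , ∣L∣≤m , P⇒∈L) = L , ≤-trans ∣L∣≤m m≤m′ , P⇒∈L

atMost-mono : {A : Set} {P Q : Pred A 0ℓ} {m : ℕ} → (∀ {x} → P x → Q x) → AtMost m Q → AtMost m P
atMost-mono P⇒Q (L , ∣L∣≤m , Q⇒∈L) = L , ∣L∣≤m , λ Px → Q⇒∈L (P⇒Q Px)

atMost-⊎ : {A : Set} {P Q : Pred A 0ℓ} {m m′ : ℕ} → AtMost m P → AtMost m′ Q → AtMost (m + m′) (λ x → P x ⊎ Q x)
atMost-⊎ (L , ∣L∣≤m , P⇒∈L) (L′ , ∣L′∣≤m′ , Q⇒∈L′) =
  L ++ L′ ,
  subst (_≤ _) (sym (length-++ L)) (+-mono-≤ ∣L∣≤m ∣L′∣≤m′) ,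
  λ { (inj₁ Px) → ∈-++⁺ˡ (P⇒∈L Px) ; (inj₂ Qx) → ∈-++⁺ʳ L (Q⇒∈L′ Qx) }

atMost-Fin : ∀ {n} → AtMost n (λ (_ : Fin n) → ⊤)
atMost-Fin {n} = allFin n , ≤-reflexive (length-tabulate id) , λ {x} _ → ∈-allFin x

atMost-injection : {A B : Set} {P : Pred B 0ℓ} {m : ℕ} (f : A → B) {xs : List A} →
  Unique xs → InjectiveOn xs f → (∀ {x} → x ∈ xs → P (f x)) → AtMost m P → length xs ≤ m
atMost-injection f uniq f-inj Pf (L , ∣L∣≤m , P⇒∈L) =
  ≤-trans (length-≤-injection f uniq f-inj (λ x∈ → P⇒∈L (Pf x∈))) ∣L∣≤m

length-cartesianProduct : {A B : Set} (xs : List A) (ys : List B) →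
  length (cartesianProduct xs ys) ≡ length xs * length ys
length-cartesianProduct []       ys = refl
length-cartesianProduct (x ∷ xs) ys = begin
  length (map (x ,_) ys ++ cartesianProduct xs ys)      ≡⟨ length-++ (map (x ,_) ys) ⟩
  length (map (x ,_) ys) + length (cartesianProduct xs ys) ≡⟨ cong₂ _+_ (length-map (x ,_) ys) (length-cartesianProduct xs ys) ⟩
  length ys + length xs * length ys                     ∎
  where open ≡-Reasoning

atMost-× : {A B : Set} {P : Pred A 0ℓ} {Q : Pred B 0ℓ} {m m′ : ℕ} →
  AtMost m P → AtMost m′ Q → AtMost (m * m′) (λ (x , y) → P x × Q y)
atMost-× (L , ∣L∣≤m , P⇒∈L) (L′ , ∣L′∣≤m′ , Q⇒∈L′) =
  cartesianProduct L L′ ,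
  subst (_≤ _) (sym (length-cartesianProduct L L′)) (*-mono-≤ ∣L∣≤m ∣L′∣≤m′) ,
  λ (Px , Qy) → ∈-cartesianProduct⁺ (P⇒∈L Px) (Q⇒∈L′ Qy)

module _ {A C : Set} (_≟_ : DecidableEquality C) (colour : A → C) where

  class : C → List A → List A
  class c = filter (λ x → colour x ≟ c)

  ∈-class⁻ : ∀ {c x} xs → x ∈ class c xs → x ∈ xs × colour x ≡ c
  ∈-class⁻ {c} xs = ∈-filter⁻ (λ x → colour x ≟ c) {xs = xs}

  pigeonhole : ∀ {B} (L : List C) {xs : List A} → Unique xs → (∀ {x} → x ∈ xs → colour x ∈ L) →
    (∀ {c} → c ∈ L → length (class c xs) ≤ B) → length xs ≤ length L * B
  pigeonhole         []      {[]}    _    _     _     = z≤n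
  pigeonhole         []      {x ∷ _} _    col∈L _     with () ← col∈L (here refl)
  pigeonhole {B} (c ∷ L) {xs}    uniq col∈L small = begin
    length xs                              ≡⟨ length-filter+filter-∁ (λ x → colour x ≟ c) xs ⟩
    length (class c xs) + length others    ≤⟨ +-mono-≤ (small (here refl)) (pigeonhole L uniq′ col∈L′ small′) ⟩
    B + length L * B                       ∎
    where
    open ≤-Reasoning
    others = filter (∁? (λ x → colour x ≟ c)) xs
    uniq′ : Unique others
    uniq′ = Unique.filter⁺ (∁? (λ x → colour x ≟ c)) uniq
    others⁻ : ∀ {x} → x ∈ others → x ∈ xs × colour x ≢ c
    others⁻ = ∈-filter⁻ (∁? (λ x → colour x ≟ c)) {xs = xs}
    col∈L′ : ∀ {x} → x ∈ others → colour x ∈ L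
    col∈L′ x∈ with others⁻ x∈
    ... | x∈xs , col≢c with col∈L x∈xs
    ...   | here col≡c = ⊥-elim (col≢c col≡c)
    ...   | there col∈ = col∈
    small′ : ∀ {d} → d ∈ L → length (class d others) ≤ B
    small′ {d} d∈L = ≤-trans
      (length-≤-injection id (Unique.filter⁺ (λ x → colour x ≟ d) uniq′) (λ _ _ eq → eq) sub)
      (small (there d∈L))
      where
      sub : ∀ {x} → x ∈ class d others → x ∈ class d xs
      sub x∈ with ∈-class⁻ others x∈
      ... | x∈others , col≡d = ∈-filter⁺ (λ x → colour x ≟ d) (proj₁ (others⁻ x∈others)) col≡d

  crowded-class : ∀ {P : Pred C 0ℓ} {m B} {xs : List A} → AtMost m P → Unique xs →
    (∀ {x} → x ∈ xs → P (colour x)) → m * B < length xs → Σ C λ c → P c × B < length (class c xs)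
  crowded-class {P} {m} {B} {xs} (L , ∣L∣≤m , P⇒∈L) uniq Pcol m*B<∣xs∣
    with all? (λ c → length (class c xs) ≤? B) L
  ... | yes small = ⊥-elim (<⇒≱ m*B<∣xs∣
        (≤-trans (pigeonhole L uniq (λ x∈ → P⇒∈L (Pcol x∈)) (All.lookup small)) (*-monoˡ-≤ B ∣L∣≤m)))
  ... | no ¬small with find (¬All⇒Any¬ (λ c → length (class c xs) ≤? B) L ¬small)
  ...   | c , _ , ¬∣class∣≤B = c , P-c , ≰⇒> ¬∣class∣≤B
    where
    P-c : P c
    P-c with class c xs in eq | ≰⇒> ¬∣class∣≤B
    ... | x ∷ _ | _ with ∈-class⁻ xs (subst (x ∈_) (sym eq) (here refl))
    ...   | x∈xs , refl = Pcol x∈xs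

ReducesTo : ℕ → ℕ → ℕ → Set
ReducesTo n p q = p ≡ q ⊎ p ≡ q + n

%-reducesTo : ∀ n .{{_ : NonZero n}} p → p < n + n → ReducesTo n p (p % n)
%-reducesTo n p p<2n with p <? n
... | yes p<n = inj₁ (sym (m<n⇒m%n≡m p<n))
... | no  p≮n = inj₂ (trans (sym p∸n+n≡p) (cong (_+ n) (sym p%n≡p∸n)))
  where
  p∸n+n≡p : p ∸ n + n ≡ p
  p∸n+n≡p = m∸n+n≡m (≮⇒≥ p≮n)
  p%n≡p∸n : p % n ≡ p ∸ n
  p%n≡p∸n = begin
    p % n           ≡⟨ cong (_% n) (sym p∸n+n≡p) ⟩
    (p ∸ n + n) % n ≡⟨ [m+n]%n≡m%n (p ∸ n) n ⟩
    (p ∸ n) % n     ≡⟨ m<n⇒m%n≡m (+-cancelʳ-< _ _ n (subst (_< n + n) (sym p∸n+n≡p) p<2n)) ⟩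
    p ∸ n           ∎
    where open ≡-Reasoning

reducesTo-unique : ∀ {n p q q′} → q < n → q′ < n → ReducesTo n p q → ReducesTo n p q′ → q ≡ q′
reducesTo-unique _ _ (inj₁ refl) (inj₁ q≡q′) = q≡q′
reducesTo-unique {n} {q′ = q′} q<n _ (inj₁ refl) (inj₂ refl) = ⊥-elim (<⇒≱ q<n (m≤n+m n q′))
reducesTo-unique {n} {q = q} _ q′<n (inj₂ refl) (inj₁ q+n≡q′) = ⊥-elim (<⇒≱ q′<n (subst (n ≤_) q+n≡q′ (m≤n+m n q)))
reducesTo-unique {n} {q = q} {q′} _ _ (inj₂ refl) (inj₂ q+n≡q′+n) = +-cancelʳ-≡ n q q′ q+n≡q′+n

private
  reducesTo-excess : ∀ {n p q} → ReducesTo n p q → Σ ℕ λ e → (e ≡ 0 ⊎ e ≡ n) × p ≡ q + e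
  reducesTo-excess {q = q} (inj₁ p≡q) = 0 , inj₁ refl , trans p≡q (sym (+-identityʳ q))
  reducesTo-excess         (inj₂ p≡q+n) = _ , inj₂ refl , p≡q+n

  excess-balance : ∀ c u₁ x e₁ u₂ y e₂ u₃ e₃ → c + u₁ ≡ x + e₁ → x + u₂ ≡ y + e₂ → c + u₃ ≡ y + e₃ →
    (u₁ + u₂) + e₃ ≡ u₃ + (e₁ + e₂)
  excess-balance c u₁ x e₁ u₂ y e₂ u₃ e₃ h₁ h₂ h₃ = +-cancelˡ-≡ c _ _ (begin
    c + ((u₁ + u₂) + e₃) ≡⟨ solve (c ∷ u₁ ∷ u₂ ∷ e₃ ∷ []) ⟩
    ((c + u₁) + u₂) + e₃ ≡⟨ cong (λ z → (z + u₂) + e₃) h₁ ⟩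
    ((x + e₁) + u₂) + e₃ ≡⟨ solve (x ∷ e₁ ∷ u₂ ∷ e₃ ∷ []) ⟩
    ((x + u₂) + e₁) + e₃ ≡⟨ cong (λ z → (z + e₁) + e₃) h₂ ⟩
    ((y + e₂) + e₁) + e₃ ≡⟨ solve (y ∷ e₂ ∷ e₁ ∷ e₃ ∷ []) ⟩
    (y + e₃) + (e₁ + e₂) ≡⟨ cong (_+ (e₁ + e₂)) (sym h₃) ⟩
    (c + u₃) + (e₁ + e₂) ≡⟨ +-assoc c u₃ _ ⟩
    c + (u₃ + (e₁ + e₂)) ∎)
    where open ≡-Reasoning

-- Offsets add modulo n: going from c to x by u₁ and on to y by u₂ is going from c to y by u₃.
reducesTo-additive : ∀ {n c u₁ x u₂ y u₃} → u₁ < n → u₂ < n → u₃ < n →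
  ReducesTo n (c + u₁) x → ReducesTo n (x + u₂) y → ReducesTo n (c + u₃) y → ReducesTo n (u₁ + u₂) u₃
reducesTo-additive {n} {c} {u₁} {x} {u₂} {y} {u₃} u₁<n u₂<n u₃<n r₁ r₂ r₃
  with reducesTo-excess r₁ | reducesTo-excess r₂ | reducesTo-excess r₃
... | e₁ , c₁ , h₁ | e₂ , c₂ , h₂ | e₃ , c₃ , h₃ = cases c₁ c₂ c₃ (excess-balance c u₁ x e₁ u₂ y e₂ u₃ e₃ h₁ h₂ h₃)
  where
  U = u₁ + u₂
  cases : e₁ ≡ 0 ⊎ e₁ ≡ n → e₂ ≡ 0 ⊎ e₂ ≡ n → e₃ ≡ 0 ⊎ e₃ ≡ n → U + e₃ ≡ u₃ + (e₁ + e₂) → ReducesTo n U u₃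
  cases (inj₁ refl) (inj₁ refl) (inj₁ refl) eq = inj₁ (trans (sym (+-identityʳ U)) (trans eq (+-identityʳ u₃)))
  cases (inj₁ refl) (inj₁ refl) (inj₂ refl) eq =
    ⊥-elim (<⇒≱ u₃<n (≤-trans (m≤n+m n U) (≤-reflexive (trans eq (+-identityʳ u₃)))))
  cases (inj₁ refl) (inj₂ refl) (inj₁ refl) eq = inj₂ (trans (sym (+-identityʳ U)) eq)
  cases (inj₂ refl) (inj₁ refl) (inj₁ refl) eq =
    inj₂ (trans (sym (+-identityʳ U)) (trans eq (cong (u₃ +_) (+-identityʳ n))))
  cases (inj₁ refl) (inj₂ refl) (inj₂ refl) eq = inj₁ (+-cancelʳ-≡ n U u₃ eq)
  cases (inj₂ refl) (inj₁ refl) (inj₂ refl) eq = inj₁ (+-cancelʳ-≡ n U u₃ (trans eq (cong (u₃ +_) (+-identityʳ n))))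
  cases (inj₂ refl) (inj₂ refl) (inj₁ refl) eq = ⊥-elim (<⇒≱ (+-mono-< u₁<n u₂<n)
    (≤-trans (m≤n+m (n + n) u₃) (≤-reflexive (sym (trans (sym (+-identityʳ U)) eq)))))
  cases (inj₂ refl) (inj₂ refl) (inj₂ refl) eq = inj₂ (+-cancelʳ-≡ n U (u₃ + n) (trans eq (sym (+-assoc u₃ n n))))

module _ {n : ℕ} where

  offset : Fin n → Fin n → ℕ
  offset x y with toℕ x ≤? toℕ y
  ... | yes _ = toℕ y ∸ toℕ x
  ... | no  _ = n ∸ toℕ x + toℕ y

  offset<n : ∀ x y → offset x y < n
  offset<n x y with toℕ x ≤? toℕ y
  ... | yes _   = ≤-<-trans (m∸n≤m (toℕ y) (toℕ x)) (toℕ<n y)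
  ... | no  x≰y = subst (n ∸ toℕ x + toℕ y <_) (m∸n+n≡m (<⇒≤ (toℕ<n x))) (+-monoʳ-< (n ∸ toℕ x) (≰⇒> x≰y))

  offset-reducesTo : ∀ x y → ReducesTo n (toℕ x + offset x y) (toℕ y)
  offset-reducesTo x y with toℕ x ≤? toℕ y
  ... | yes x≤y = inj₁ (m+[n∸m]≡n x≤y)
  ... | no  _   = inj₂ (begin
    toℕ x + (n ∸ toℕ x + toℕ y) ≡⟨ sym (+-assoc (toℕ x) (n ∸ toℕ x) (toℕ y)) ⟩
    toℕ x + (n ∸ toℕ x) + toℕ y ≡⟨ cong (_+ toℕ y) (m+[n∸m]≡n (<⇒≤ (toℕ<n x))) ⟩
    n + toℕ y                   ≡⟨ +-comm n (toℕ y) ⟩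
    toℕ y + n                   ∎)
    where open ≡-Reasoning

  offset-self : ∀ x → offset x x ≡ 0
  offset-self x with toℕ x ≤? toℕ x
  ... | yes _ = n∸n≡0 (toℕ x)
  ... | no  x≰x = ⊥-elim (x≰x ≤-refl)

  offset-triangle : ∀ x y z → ReducesTo n (offset x y + offset y z) (offset x z)
  offset-triangle x y z = reducesTo-additive (offset<n x y) (offset<n y z) (offset<n x z)
    (offset-reducesTo x y) (offset-reducesTo y z) (offset-reducesTo x z)

  offset-injective : ∀ {c x y} → offset c x ≡ offset c y → x ≡ y
  offset-injective {c} {x} {y} eq = toℕ-injective (reducesTo-unique (toℕ<n x) (toℕ<n y)
    (offset-reducesTo c x) (subst (λ u → ReducesTo n (toℕ c + u) (toℕ y)) (sym eq) (offset-reducesTo c y)))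

∈-range : ∀ {lo len v} → lo ≤ v → v < lo + len → v ∈ applyUpTo (lo +_) len
∈-range {lo} {len} {v} lo≤v v<lo+len = subst (_∈ applyUpTo (lo +_) len) (m+[n∸m]≡n lo≤v)
  (∈-applyUpTo⁺ (lo +_) (+-cancelˡ-< lo _ _ (subst (_< lo + len) (sym (m+[n∸m]≡n lo≤v)) v<lo+len)))

InWindow : ∀ {n} → Fin n → ℕ → ℕ → Fin n → Set
InWindow c lo len x = lo ≤ offset c x × offset c x < lo + len

atMost-window : ∀ {n} (c : Fin n) lo len → AtMost len (InWindow c lo len)
atMost-window {n} c lo len =
  window ,
  ≤-trans (length-≤-injection (offset c) (Unique.filter⁺ inWindow? (Unique.allFin⁺ n))
             (λ _ _ → offset-injective {c = c}) (λ x∈ → uncurry ∈-range (proj₂ (∈-filter⁻ inWindow? {xs = allFin n} x∈))))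
          (≤-reflexive (length-applyUpTo (lo +_) len)) ,
  λ {x} inWindow → ∈-filter⁺ inWindow? (∈-allFin x) inWindow
  where
  inWindow? : ∀ x → Dec (InWindow c lo len x)
  inWindow? x = (lo ≤? offset c x) ×-dec (offset c x <? lo + len)
  window = filter inWindow? (allFin n)

NearOffset : ℕ → ℕ → ℕ → Set
NearOffset n a u = u < a ⊎ n < u + a

-- Cyclic distance less than a: the intervals of length a following x and y meet.
Near : ∀ {n} → ℕ → Fin n → Fin n → Set
Near {n} a x y = NearOffset n a (offset x y)

near? : ∀ {n} a → Decidable₂ (Near {n} a)
near? {n} a x y = (offset x y <? a) ⊎-dec (n <? offset x y + a)

near-sym : ∀ {n a} {x y : Fin n} → 0 < a → Near a x y → Near a y x
near-sym {n} {a} {x} {y} 0<a near with subst (ReducesTo n _) (offset-self x) (offset-triangle x y x)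
... | inj₁ sum≡0 = inj₁ (subst (_< a) (sym (m+n≡0⇒n≡0 (offset x y) sum≡0)) 0<a)
... | inj₂ sum≡n = flip near
  where
  open ≤-Reasoning
  flip : Near a x y → Near a y x
  flip (inj₁ xy<a) = inj₂ (begin-strict
    n                         ≡⟨ sym sum≡n ⟩
    offset x y + offset y x   <⟨ +-monoˡ-< (offset y x) xy<a ⟩
    a + offset y x            ≡⟨ +-comm a (offset y x) ⟩
    offset y x + a            ∎)
  flip (inj₂ n<xy+a) = inj₁ (+-cancelˡ-< (offset x y) (offset y x) a (begin-strict
    offset x y + offset y x   ≡⟨ sum≡n ⟩
    n                         <⟨ n<xy+a ⟩
    offset x y + a            ∎))

intervalsMeet⇒near : ∀ {n} .{{_ : NonZero n}} {a} (i i′ : Fin n) → a < n →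
  IntervalsMeet n (toℕ i) (toℕ i′) a → Near a i i′
intervalsMeet⇒near {n} {a} i i′ a<n (x , (t , t<a , x≡) , (t′ , t′<a , x≡′)) = near
  (reducesTo-additive (offset<n i i′) (≤-<-trans t′<a a<n) (≤-<-trans t<a a<n)
    (offset-reducesTo i i′) (reaches i′ t′ t′<a x≡′) (reaches i t t<a x≡))
  where
  reaches : ∀ j s → s < a → toℕ x ≡ (toℕ j + suc s) % n → ReducesTo n (toℕ j + suc s) (toℕ x)
  reaches j s s<a x≡ = subst (ReducesTo n (toℕ j + suc s)) (sym x≡)
    (%-reducesTo n (toℕ j + suc s) (+-mono-< (toℕ<n j) (≤-<-trans s<a a<n)))
  near : ReducesTo n (offset i i′ + suc t′) (suc t) → Near a i i′
  near (inj₁ eq) = inj₁ (<-≤-trans (subst (offset i i′ <_) eq (m<m+n (offset i i′) (s≤s z≤n))) t<a)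
  near (inj₂ eq) = inj₂ (begin-strict
    n                     <⟨ m<n+m n (s≤s z≤n) ⟩
    suc t + n             ≡⟨ sym eq ⟩
    offset i i′ + suc t′  ≤⟨ +-monoʳ-≤ (offset i i′) t′<a ⟩
    offset i i′ + a       ∎)
    where open ≤-Reasoning

-- With n = a + M + a′, the points near c are those with offset in [0, a) ∪ [a + M, n).
module Neighbourhoods (a′ M : ℕ) (a′+a′<M : a′ + a′ < M) where

  a n : ℕ
  a = suc a′
  n = a + M + a′

  private
    fits⇒below : ∀ {u} → u + a ≤ n → u < a + M
    fits⇒below {u} u+a≤n = +-cancelʳ-≤ a′ (suc u) (a + M) (subst (_≤ n) (+-suc u a′) u+a≤n)

    overlaps⇒above : ∀ {u} → n < u + a → a + M ≤ u
    overlaps⇒above {u} n<u+a = +-cancelʳ-≤ a′ (a + M) u (≤-pred (subst (n <_) (+-suc u a′) n<u+a))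

    far-bounds : ∀ {u} → ¬ NearOffset n a u → a ≤ u × u + a ≤ n
    far-bounds far = ≮⇒≥ (λ u<a → far (inj₁ u<a)) , ≮⇒≥ (λ n<u+a → far (inj₂ n<u+a))

    a+a≤n : a + a ≤ n
    a+a≤n = ≤-trans (+-monoʳ-≤ a (+-monoˡ-≤ a′ (≤-trans (s≤s z≤n) a′+a′<M))) (≤-reflexive (sym (+-assoc a M a′)))

    -- Below, s, u and v are the offsets from c to c′, from c to x and from c′ to x.
    ahead-window : ∀ s d u v → v < n → s + d ≡ a → s < a → a ≤ u → u + a ≤ n → NearOffset n a v →
      ReducesTo n (s + v) u → d ≤ v × v < d + s
    ahead-window s d u v _ s+d≡a _ a≤u _ (inj₁ v<a) (inj₁ s+v≡u) =
      +-cancelˡ-≤ s d v (subst (_≤ s + v) (sym s+d≡a) (subst (a ≤_) (sym s+v≡u) a≤u)) ,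
      subst (v <_) (trans (sym s+d≡a) (+-comm s d)) v<a
    ahead-window s d u v _ _ _ _ u+a≤n (inj₂ n<v+a) (inj₁ s+v≡u) =
      ⊥-elim (<⇒≱ n<v+a (≤-trans (+-monoˡ-≤ a (subst (v ≤_) s+v≡u (m≤n+m v s))) u+a≤n))
    ahead-window s d u v _ _ s<a _ _ (inj₁ v<a) (inj₂ s+v≡u+n) =
      ⊥-elim (<⇒≱ (+-mono-< s<a v<a) (≤-trans a+a≤n (subst (n ≤_) (sym s+v≡u+n) (m≤n+m n u))))
    ahead-window s d u v v<n _ s<a a≤u _ (inj₂ _) (inj₂ s+v≡u+n) =
      ⊥-elim (<⇒≱ s<a (≤-trans a≤u (<⇒≤ (+-cancelʳ-< n u s (subst (_< s + n) s+v≡u+n (+-monoʳ-< s v<n))))))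

    behind-window : ∀ s r u v → s + r ≡ n → n < s + a → a ≤ u → u + a ≤ n → NearOffset n a v →
      ReducesTo n (s + v) u → a + M ≤ v × v < a + M + r
    behind-window s r u v _ n<s+a _ u+a≤n _ (inj₁ s+v≡u) =
      ⊥-elim (<⇒≱ n<s+a (≤-trans (+-monoˡ-≤ a (subst (s ≤_) s+v≡u (m≤m+n s v))) u+a≤n))
    behind-window s r u v s+r≡n _ a≤u u+a≤n near (inj₂ s+v≡u+n) = bounds near
      where
      v≡u+r : v ≡ u + r
      v≡u+r = +-cancelˡ-≡ s v (u + r) (trans s+v≡u+n (trans (cong (u +_) (sym s+r≡n)) (solve (u ∷ s ∷ r ∷ []))))
      bounds : NearOffset n a v → a + M ≤ v × v < a + M + r
      bounds (inj₁ v<a)   = ⊥-elim (<⇒≱ v<a (≤-trans a≤u (subst (u ≤_) (sym v≡u+r) (m≤m+n u r))))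
      bounds (inj₂ n<v+a) = overlaps⇒above n<v+a , subst (_< a + M + r) (sym v≡u+r) (+-monoˡ-< r (fits⇒below u+a≤n))

    between-windows : ∀ s u v → a ≤ s → s + a ≤ n → u < n → v < n → NearOffset n a u → NearOffset n a v →
      ReducesTo n (s + v) u → (u < a × s ≤ u + a′) ⊎ (a + M ≤ u × u < s + a)
    between-windows s u v a≤s _ _ _ (inj₁ u<a) _ (inj₁ s+v≡u) =
      ⊥-elim (<⇒≱ u<a (≤-trans a≤s (subst (s ≤_) s+v≡u (m≤m+n s v))))
    between-windows s u v _ s+a≤n _ _ (inj₁ _) (inj₁ v<a) (inj₂ s+v≡u+n) =
      ⊥-elim (<⇒≱ (+-monoʳ-< s v<a) (≤-trans s+a≤n (subst (n ≤_) (sym s+v≡u+n) (m≤n+m n u))))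
    between-windows s u v _ _ _ _ (inj₁ u<a) (inj₂ n<v+a) (inj₂ s+v≡u+n) =
      inj₁ (u<a , ≤-pred (subst (s <_) (+-suc u a′) s<u+a))
      where
      s<u+a : s < u + a
      s<u+a = +-cancelʳ-< n s (u + a) (begin-strict
        s + n        ≡⟨ +-comm s n ⟩
        n + s        <⟨ +-monoˡ-< s n<v+a ⟩
        (v + a) + s  ≡⟨ +-comm (v + a) s ⟩
        s + (v + a)  ≡⟨ sym (+-assoc s v a) ⟩
        (s + v) + a  ≡⟨ cong (_+ a) s+v≡u+n ⟩
        (u + n) + a  ≡⟨ +-assoc u n a ⟩
        u + (n + a)  ≡⟨ cong (u +_) (+-comm n a) ⟩
        u + (a + n)  ≡⟨ sym (+-assoc u a n) ⟩
        (u + a) + n  ∎)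
        where open ≤-Reasoning
    between-windows s u v _ _ _ _ (inj₂ n<u+a) (inj₁ v<a) (inj₁ s+v≡u) =
      inj₂ (overlaps⇒above n<u+a , subst (_< s + a) s+v≡u (+-monoʳ-< s v<a))
    between-windows s u v a≤s _ u<n _ (inj₂ _) (inj₂ n<v+a) (inj₁ s+v≡u) = ⊥-elim (<⇒≱ u<n (begin
      n            ≡⟨ +-comm (a + M) a′ ⟩
      a′ + (a + M) ≤⟨ +-monoˡ-≤ (a + M) (≤-trans (n≤1+n a′) a≤s) ⟩
      s + (a + M)  ≤⟨ +-monoʳ-≤ s (overlaps⇒above n<v+a) ⟩
      s + v        ≡⟨ s+v≡u ⟩
      u            ∎))
      where open ≤-Reasoning
    between-windows s u v _ s+a≤n _ v<n (inj₂ n<u+a) _ (inj₂ s+v≡u+n) =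
      ⊥-elim (<⇒≱ (+-cancelʳ-< a s u (≤-<-trans s+a≤n n<u+a))
                  (<⇒≤ (+-cancelʳ-< n u s (subst (_< s + n) s+v≡u+n (+-monoʳ-< s v<n)))))

  atMost-near : (c : Fin n) → AtMost (a + a′) (Near a c)
  atMost-near c = atMost-mono windows (atMost-⊎ (atMost-window c 0 a) (atMost-window c (a + M) a′))
    where
    windows : ∀ {x} → Near a c x → InWindow c 0 a x ⊎ InWindow c (a + M) a′ x
    windows (inj₁ u<a)   = inj₁ (z≤n , u<a)
    windows {x} (inj₂ n<u+a) = inj₂ (overlaps⇒above n<u+a , offset<n c x)

  atMost-far : (c : Fin n) → AtMost M (λ x → ¬ Near a c x)
  atMost-far c = atMost-mono window (atMost-window c a M)
    where
    window : ∀ {x} → ¬ Near a c x → InWindow c a M x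
    window far = proj₁ (far-bounds far) , fits⇒below (proj₂ (far-bounds far))

  atMost-near∖near : (c c′ : Fin n) → Near a c c′ → AtMost a′ (λ x → Near a c′ x × ¬ Near a c x)
  atMost-near∖near c c′ (inj₁ s<a) = atMost-weaken (≤-pred s<a) (atMost-mono window (atMost-window c′ (a ∸ s) s))
    where
    s = offset c c′
    window : ∀ {x} → Near a c′ x × ¬ Near a c x → InWindow c′ (a ∸ s) s x
    window {x} (near′ , far) = ahead-window s (a ∸ s) (offset c x) (offset c′ x) (offset<n c′ x)
      (m+[n∸m]≡n (<⇒≤ s<a)) s<a (proj₁ (far-bounds far)) (proj₂ (far-bounds far)) near′ (offset-triangle c c′ x)
  atMost-near∖near c c′ (inj₂ n<s+a) = atMost-weaken r≤a′ (atMost-mono window (atMost-window c′ (a + M) r))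
    where
    s = offset c c′
    r = n ∸ s
    s+r≡n : s + r ≡ n
    s+r≡n = m+[n∸m]≡n (<⇒≤ (offset<n c c′))
    r≤a′ : r ≤ a′
    r≤a′ = ≤-pred (+-cancelˡ-< s r a (subst (_< s + a) (sym s+r≡n) n<s+a))
    window : ∀ {x} → Near a c′ x × ¬ Near a c x → InWindow c′ (a + M) r x
    window {x} (near′ , far) = behind-window s r (offset c x) (offset c′ x)
      s+r≡n n<s+a (proj₁ (far-bounds far)) (proj₂ (far-bounds far)) near′ (offset-triangle c c′ x)

  atMost-near∩near : (c c′ : Fin n) → ¬ Near a c c′ → AtMost a′ (λ x → Near a c x × Near a c′ x)
  atMost-near∩near c c′ far with far-bounds far | offset c c′ ≤? M
  ... | a≤s , s+a≤n | yes s≤M =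
    atMost-weaken (∸-monoʳ-≤ a (m+n≤o⇒m≤o∸n 1 a≤s)) (atMost-mono window (atMost-window c (s ∸ a′) (a ∸ (s ∸ a′))))
    where
    s = offset c c′
    window : ∀ {x} → Near a c x × Near a c′ x → InWindow c (s ∸ a′) (a ∸ (s ∸ a′)) x
    window {x} (near , near′) with between-windows s (offset c x) (offset c′ x) a≤s s+a≤n
                                     (offset<n c x) (offset<n c′ x) near near′ (offset-triangle c c′ x)
    ... | inj₁ (u<a , s≤u+a′) =
      ≤-trans (∸-monoˡ-≤ a′ s≤u+a′) (≤-reflexive (m+n∸n≡m _ a′)) , <-≤-trans u<a (m≤n+m∸n a (s ∸ a′))
    ... | inj₂ (a+M≤u , u<s+a) =
      ⊥-elim (<⇒≱ u<s+a (≤-trans (+-monoˡ-≤ a s≤M) (≤-trans (≤-reflexive (+-comm M a)) a+M≤u)))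
  ... | a≤s , s+a≤n | no s≰M =
    atMost-weaken s∸M≤a′ (atMost-mono window (atMost-window c (a + M) (s ∸ M)))
    where
    s = offset c c′
    s∸M≤a′ : s ∸ M ≤ a′
    s∸M≤a′ = ≤-trans (∸-monoˡ-≤ M (+-cancelʳ-≤ a s (M + a′)
      (≤-trans s+a≤n (≤-reflexive (trans (+-assoc a M a′) (+-comm a (M + a′))))))) (≤-reflexive (m+n∸m≡n M a′))
    window : ∀ {x} → Near a c x × Near a c′ x → InWindow c (a + M) (s ∸ M) x
    window {x} (near , near′) with between-windows s (offset c x) (offset c′ x) a≤s s+a≤n
                                     (offset<n c x) (offset<n c′ x) near near′ (offset-triangle c c′ x)
    ... | inj₁ (u<a , s≤u+a′) =
      ⊥-elim (s≰M (≤-trans s≤u+a′ (≤-trans (+-monoˡ-≤ a′ (<⇒≤pred u<a)) (<⇒≤ a′+a′<M))))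
    ... | inj₂ (a+M≤u , u<s+a) = a+M≤u , subst (offset c x <_) (begin
      s + a            ≡⟨ +-comm s a ⟩
      a + s            ≡⟨ cong (a +_) (sym (m+[n∸m]≡n (<⇒≤ (≰⇒> s≰M)))) ⟩
      a + (M + (s ∸ M)) ≡⟨ sym (+-assoc a M (s ∸ M)) ⟩
      a + M + (s ∸ M)  ∎) u<s+a
      where open ≡-Reasoning

  private
    K : ℕ
    K = M + a′

    fold : ℕ → ℕ
    fold u with u <? a
    ... | yes _ = u
    ... | no  _ = u ∸ K

    fold-spec : ∀ u → NearOffset n a u → (u < a × fold u ≡ u) ⊎ (a + M ≤ u × fold u + K ≡ u)
    fold-spec u near with u <? a
    fold-spec u _            | yes u<a = inj₁ (u<a , refl)
    fold-spec u (inj₁ u<a)   | no  u≮a = ⊥-elim (u≮a u<a)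
    fold-spec u (inj₂ n<u+a) | no  _   = inj₂ (a+M≤u , m∸n+n≡m (≤-trans (≤-reflexive (+-comm M a′)) (≤-trans (n≤1+n _) a+M≤u)))
      where
      a+M≤u = overlaps⇒above n<u+a

    K-far : ¬ NearOffset n a K
    K-far (inj₁ K<a)   = <⇒≱ K<a (+-monoˡ-≤ a′ (≤-trans (s≤s z≤n) a′+a′<M))
    K-far (inj₂ n<K+a) = <-irrefl (trans (+-assoc a M a′) (+-comm a K)) n<K+a

    gap-far : ∀ {c x y : Fin n} → offset c y ≡ offset c x + K → ¬ Near a x y
    gap-far {c} {x} {y} eq with offset-triangle c x y
    ... | inj₁ sum≡ = λ near → K-far (subst (NearOffset n a) (+-cancelˡ-≡ (offset c x) _ _ (trans sum≡ eq)) near)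
    ... | inj₂ sum≡ = λ _ → <⇒≱ (offset<n x y) (+-cancelˡ-≤ (offset c x) n (offset x y)
      (≤-trans (+-monoˡ-≤ n (m≤m+n (offset c x) K)) (≤-reflexive (sym (trans sum≡ (cong (_+ n) eq))))))

  -- The offsets from the first point lie in [1, a) ∪ [a + M, n); subtracting K from the upper ones
  -- folds them injectively into [1, a), as points whose offsets differ by K are far apart.
  pairwiseNear⇒length≤ : {A : Set} (g : A → Fin n) {xs : List A} → Unique xs → InjectiveOn xs g →
    (∀ {x y} → x ∈ xs → y ∈ xs → Near a (g x) (g y)) → length xs ≤ a
  pairwiseNear⇒length≤ g {[]}      _             _     _    = z≤n
  pairwiseNear⇒length≤ g {x₀ ∷ xs} (x₀∉xs ∷ uniq) g-inj near =
    s≤s (≤-trans (length-≤-injection φ uniq φ-inj φ∈) (≤-reflexive (length-applyUpTo (1 +_) a′)))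
    where
    U : _ → ℕ
    U y = offset (g x₀) (g y)
    φ : _ → ℕ
    φ y = fold (U y)
    U-injective : ∀ {y z} → y ∈ x₀ ∷ xs → z ∈ x₀ ∷ xs → U y ≡ U z → y ≡ z
    U-injective y∈ z∈ eq = g-inj y∈ z∈ (offset-injective {c = g x₀} eq)
    spec : ∀ {y} → y ∈ xs → (U y < a × φ y ≡ U y) ⊎ (a + M ≤ U y × φ y + K ≡ U y)
    spec y∈ = fold-spec _ (near (here refl) (there y∈))
    0<U : ∀ {y} → y ∈ xs → 0 < U y
    0<U {y} y∈ with U y in eq
    ... | suc _ = s≤s z≤n
    ... | zero  = ⊥-elim (All.lookup x₀∉xs y∈ (U-injective (here refl) (there y∈) (trans (offset-self (g x₀)) (sym eq))))
    φ∈ : ∀ {y} → y ∈ xs → φ y ∈ applyUpTo (1 +_) a′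
    φ∈ {y} y∈ with spec y∈
    ... | inj₁ (U<a , φ≡U) = ∈-range (subst (0 <_) (sym φ≡U) (0<U y∈)) (subst (_< a) (sym φ≡U) U<a)
    ... | inj₂ (a+M≤U , φ+K≡U) = ∈-range
      (+-cancelʳ-≤ K 1 (φ y) (≤-trans (≤-reflexive (cong suc (+-comm M a′))) (≤-trans a+M≤U (≤-reflexive (sym φ+K≡U)))))
      (+-cancelʳ-< K (φ y) a (subst (_< a + K) (sym φ+K≡U) (subst (U y <_) (+-assoc a M a′) (offset<n (g x₀) (g y)))))
    mixed : ∀ {y z} → y ∈ xs → z ∈ xs → φ y ≡ U y → φ z + K ≡ U z → φ y ≢ φ z
    mixed y∈ z∈ φ≡U φ+K≡U φy≡φz =
      gap-far {c = g x₀} (trans (sym φ+K≡U) (cong (_+ K) (trans (sym φy≡φz) φ≡U))) (near (there y∈) (there z∈))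
    φ-inj : InjectiveOn xs φ
    φ-inj y∈ z∈ eq with spec y∈ | spec z∈
    ... | inj₁ (_ , φ≡U) | inj₁ (_ , φ≡U′) = U-injective (there y∈) (there z∈) (trans (sym φ≡U) (trans eq φ≡U′))
    ... | inj₂ (_ , φ+K≡U) | inj₂ (_ , φ+K≡U′) =
      U-injective (there y∈) (there z∈) (trans (sym φ+K≡U) (trans (cong (_+ K) eq) φ+K≡U′))
    ... | inj₁ (_ , φ≡U) | inj₂ (_ , φ+K≡U) = ⊥-elim (mixed y∈ z∈ φ≡U φ+K≡U eq)
    ... | inj₂ (_ , φ+K≡U) | inj₁ (_ , φ≡U) = ⊥-elim (mixed z∈ y∈ φ≡U φ+K≡U (sym eq))

  far-pair : {A : Set} (g : A → Fin n) {xs : List A} → Unique xs → InjectiveOn xs g → a < length xs →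
    ∃₂ λ x y → x ∈ xs × y ∈ xs × ¬ Near a (g x) (g y)
  far-pair g {xs} uniq g-inj a<∣xs∣ with allPairs-or-counterexample (λ x y → near? a (g x) (g y)) xs
  ... | inj₁ allNear = ⊥-elim (<⇒≱ a<∣xs∣ (pairwiseNear⇒length≤ g uniq g-inj allNear))
  ... | inj₂ farPair = farPair

module OneDirection (k′ ℓ′ M₁ M₂ : ℕ) (k′+k′<M₁ : k′ + k′ < M₁) (ℓ′+ℓ′<M₂ : ℓ′ + ℓ′ < M₂)
  {A : Set} (col : A → Fin (suc k′ + M₁ + k′)) (row : A → Fin (suc ℓ′ + M₂ + ℓ′))
  (xs : List A) (uniq : Unique xs)
  (col-row-injective : ∀ {x y} → x ∈ xs → y ∈ xs → col x ≡ col y → row x ≡ row y → x ≡ y)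
  (proj-intersecting : ∀ {x y} → x ∈ xs → y ∈ xs → Near (suc k′) (col x) (col y) ⊎ Near (suc ℓ′) (row x) (row y))
  where

  module Cols = Neighbourhoods k′ M₁ k′+k′<M₁
  module Rows = Neighbourhoods ℓ′ M₂ ℓ′+ℓ′<M₂
  open Cols public using () renaming (a to k; n to n₁)
  open Rows public using () renaming (a to ℓ; n to n₂)

  column : Fin n₁ → List A → List A
  column = class _≟ᶠ_ col

  row-injective-on-column : ∀ {i ys} → (∀ {x} → x ∈ ys → x ∈ xs) → InjectiveOn (column i ys) row
  row-injective-on-column {i} {ys} ys⊆xs x∈ y∈ row-eq with ∈-class⁻ _≟ᶠ_ col ys x∈ | ∈-class⁻ _≟ᶠ_ col ys y∈
  ... | x∈ys , refl | y∈ys , col-eq = col-row-injective (ys⊆xs x∈ys) (ys⊆xs y∈ys) (sym col-eq) row-eq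

  record SplitColumn : Set where
    constructor splitColumn
    field
      {y y′}   : A
      y∈       : y ∈ xs
      y′∈      : y′ ∈ xs
      same-col : col y ≡ col y′
      far-rows : ¬ Near ℓ (row y) (row y′)

  bounded-or-splitColumn : length xs ≤ n₁ * ℓ ⊎ SplitColumn
  bounded-or-splitColumn with length xs ≤? n₁ * ℓ
  ... | yes bounded = inj₁ bounded
  ... | no  unbounded with crowded-class _≟ᶠ_ col atMost-Fin uniq (λ _ → tt) (≰⇒> unbounded)
  ...   | i , _ , ℓ<∣column∣ with Rows.far-pair row (Unique.filter⁺ (λ x → col x ≟ᶠ i) uniq) (row-injective-on-column id) ℓ<∣column∣
  ...     | y , y′ , y∈ , y′∈ , far with ∈-class⁻ _≟ᶠ_ col xs y∈ | ∈-class⁻ _≟ᶠ_ col xs y′∈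
  ...       | y∈xs , col-y | y′∈xs , col-y′ = inj₂ (splitColumn y∈xs y′∈xs (trans col-y (sym col-y′)) far)

  pair : A → Fin n₁ × Fin n₂
  pair x = col x , row x

  atMost-pairs : ∀ {ys m} {P : Pred (Fin n₁ × Fin n₂) 0ℓ} → Unique ys →
    (∀ {x} → x ∈ ys → x ∈ xs × P (pair x)) → AtMost m P → length ys ≤ m
  atMost-pairs uniq-ys in-P = atMost-injection pair uniq-ys
    (λ x∈ y∈ eq → col-row-injective (proj₁ (in-P x∈)) (proj₁ (in-P y∈)) (cong proj₁ eq) (cong proj₂ eq))
    (λ x∈ → proj₂ (in-P x∈))

  nearColumn? : (i : Fin n₁) → Decidable (λ x → Near k i (col x))
  nearColumn? i x = near? k i (col x)

  nearRow? : (j : Fin n₂) → Decidable (λ x → Near ℓ j (row x))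
  nearRow? j x = near? ℓ j (row x)

  cross : Fin n₁ → Fin n₂ → List A
  cross i j = filter (∁? (nearRow? j)) (filter (nearColumn? i) xs)

  ∈-cross⁻ : ∀ i j {x} → x ∈ cross i j → x ∈ xs × Near k i (col x) × ¬ Near ℓ j (row x)
  ∈-cross⁻ i j x∈ with ∈-filter⁻ (∁? (nearRow? j)) {xs = filter (nearColumn? i) xs} x∈
  ... | x∈′ , far-row with ∈-filter⁻ (nearColumn? i) {xs = xs} x∈′
  ...   | x∈xs , near-col = x∈xs , near-col , far-row

  cross-unique : ∀ i j → Unique (cross i j)
  cross-unique i j = Unique.filter⁺ (∁? (nearRow? j)) (Unique.filter⁺ (nearColumn? i) uniq)

  module _ (split : SplitColumn) where
    open SplitColumn split

    farColumn⇒nearRows : ∀ {x} → x ∈ xs → ¬ Near k (col y) (col x) → Near ℓ (row y) (row x) × Near ℓ (row y′) (row x)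
    farColumn⇒nearRows {x} x∈ far-col with proj-intersecting y∈ x∈ | proj-intersecting y′∈ x∈
    ... | inj₁ near-col | _           = ⊥-elim (far-col near-col)
    ... | inj₂ _        | inj₁ near-col = ⊥-elim (far-col (subst (λ i → Near k i (col x)) (sym same-col) near-col))
    ... | inj₂ near     | inj₂ near′  = near , near′

    bounded : ∀ j → length (cross (col y) j) ≤ (k + k′) * ℓ′ → length xs ≤ n₁ * ℓ′ + (k + k′) * (ℓ + ℓ′)
    bounded j small-cross = begin
      length xs                                            ≡⟨ length-filter+filter-∁ (nearColumn? i) xs ⟩
      length nearCol + length farCol                       ≡⟨ cong (_+ length farCol) (length-filter+filter-∁ (nearRow? j) nearCol) ⟩
      length nearBoth + length (cross i j) + length farCol ≤⟨ +-mono-≤ (+-mono-≤ nearBoth-bound small-cross) farCol-bound ⟩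
      (k + k′) * (ℓ + ℓ′) + (k + k′) * ℓ′ + M₁ * ℓ′        ≡⟨ rearrange k′ ℓ′ M₁ ⟩
      n₁ * ℓ′ + (k + k′) * (ℓ + ℓ′)                        ∎
      where
      open ≤-Reasoning
      i = col y
      nearCol  = filter (nearColumn? i) xs
      farCol   = filter (∁? (nearColumn? i)) xs
      nearBoth = filter (nearRow? j) nearCol
      rearrange : ∀ k′ ℓ′ M₁ → (suc k′ + k′) * (suc ℓ′ + ℓ′) + (suc k′ + k′) * ℓ′ + M₁ * ℓ′
                             ≡ (suc k′ + M₁ + k′) * ℓ′ + (suc k′ + k′) * (suc ℓ′ + ℓ′)
      rearrange = solve-∀
      nearBoth-bound : length nearBoth ≤ (k + k′) * (ℓ + ℓ′)
      nearBoth-bound = atMost-pairs (Unique.filter⁺ (nearRow? j) (Unique.filter⁺ (nearColumn? i) uniq)) in-P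
        (atMost-× (Cols.atMost-near i) (Rows.atMost-near j))
        where
        in-P : ∀ {x} → x ∈ nearBoth → x ∈ xs × Near k i (col x) × Near ℓ j (row x)
        in-P x∈ with ∈-filter⁻ (nearRow? j) {xs = nearCol} x∈
        ... | x∈′ , near-row with ∈-filter⁻ (nearColumn? i) {xs = xs} x∈′
        ...   | x∈xs , near-col = x∈xs , near-col , near-row
      farCol-bound : length farCol ≤ M₁ * ℓ′
      farCol-bound = atMost-pairs (Unique.filter⁺ (∁? (nearColumn? i)) uniq) in-P
        (atMost-× (Cols.atMost-far i) (Rows.atMost-near∩near (row y) (row y′) far-rows))
        where
        in-P : ∀ {x} → x ∈ farCol → x ∈ xs × ¬ Near k i (col x) × Near ℓ (row y) (row x) × Near ℓ (row y′) (row x)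
        in-P x∈ with ∈-filter⁻ (∁? (nearColumn? i)) {xs = xs} x∈
        ... | x∈xs , far-col = x∈xs , far-col , farColumn⇒nearRows x∈xs far-col

    bounded-or-crowdedColumn : ∀ j → length xs ≤ n₁ * ℓ′ + (k + k′) * (ℓ + ℓ′)
      ⊎ Σ (Fin n₁) λ i → Near k (col y) i × ℓ′ < length (column i (cross (col y) j))
    bounded-or-crowdedColumn j with length (cross (col y) j) ≤? (k + k′) * ℓ′
    ... | yes small = inj₁ (bounded j small)
    ... | no  big   = inj₂ (crowded-class _≟ᶠ_ col (Cols.atMost-near (col y)) (cross-unique (col y) j)
                              (λ x∈ → proj₁ (proj₂ (∈-cross⁻ (col y) j x∈))) (≰⇒> big))

  crowdedColumn-escapes : ∀ i₀ i₁ j₀ j₁ → Near ℓ j₀ j₁ → ℓ′ < length (column i₁ (cross i₀ j₀)) →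
    ∃ λ x → x ∈ xs × col x ≡ i₁ × ¬ Near ℓ j₁ (row x)
  crowdedColumn-escapes i₀ i₁ j₀ j₁ near crowded with all? (nearRow? j₁) (column i₁ (cross i₀ j₀))
  ... | yes allNear = ⊥-elim (<⇒≱ crowded
        (atMost-injection row (Unique.filter⁺ (λ x → col x ≟ᶠ i₁) (cross-unique i₀ j₀))
          (row-injective-on-column (λ x∈ → proj₁ (∈-cross⁻ i₀ j₀ x∈))) near∖near (Rows.atMost-near∖near j₀ j₁ near)))
    where
    near∖near : ∀ {x} → x ∈ column i₁ (cross i₀ j₀) → Near ℓ j₁ (row x) × ¬ Near ℓ j₀ (row x)
    near∖near x∈ = All.lookup allNear x∈ , proj₂ (proj₂ (∈-cross⁻ i₀ j₀ (proj₁ (∈-class⁻ _≟ᶠ_ col (cross i₀ j₀) x∈))))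
  ... | no ¬allNear with find (¬All⇒Any¬ (nearRow? j₁) _ ¬allNear)
  ...   | x , x∈ , far-row with ∈-class⁻ _≟ᶠ_ col (cross i₀ j₀) x∈
  ...     | x∈cross , col-x = x , proj₁ (∈-cross⁻ i₀ j₀ x∈cross) , col-x , far-row

module _ (k′ ℓ′ M₁ M₂ : ℕ) (k′+k′<M₁ : k′ + k′ < M₁) (ℓ′+ℓ′<M₂ : ℓ′ + ℓ′ < M₂)
  {A : Set} (col : A → Fin (suc k′ + M₁ + k′)) (row : A → Fin (suc ℓ′ + M₂ + ℓ′))
  (xs : List A) (uniq : Unique xs)
  (col-row-injective : ∀ {x y} → x ∈ xs → y ∈ xs → col x ≡ col y → row x ≡ row y → x ≡ y)
  (proj-intersecting : ∀ {x y} → x ∈ xs → y ∈ xs → Near (suc k′) (col x) (col y) ⊎ Near (suc ℓ′) (row x) (row y))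
  where

  private
    module ByColumns = OneDirection k′ ℓ′ M₁ M₂ k′+k′<M₁ ℓ′+ℓ′<M₂ col row xs uniq
      col-row-injective proj-intersecting
    module ByRows = OneDirection ℓ′ k′ M₂ M₁ ℓ′+ℓ′<M₂ k′+k′<M₁ row col xs uniq
      (λ x∈ y∈ col-eq row-eq → col-row-injective x∈ y∈ row-eq col-eq) (λ x∈ y∈ → swap (proj-intersecting x∈ y∈))
    open ByColumns using (k; ℓ; n₁; n₂)

  crowded-columns-and-rows-clash : ∀ i₀ i₁ j₀ j₁ → Near k i₀ i₁ → Near ℓ j₀ j₁ →
    ℓ′ < length (ByColumns.column i₁ (ByColumns.cross i₀ j₀)) → k′ < length (ByRows.column j₁ (ByRows.cross j₀ i₀)) → ⊥
  crowded-columns-and-rows-clash i₀ i₁ j₀ j₁ near-i near-j crowded-i crowded-j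
    with ByColumns.crowdedColumn-escapes i₀ i₁ j₀ j₁ near-j crowded-i | ByRows.crowdedColumn-escapes j₀ j₁ i₀ i₁ near-i crowded-j
  ... | x , x∈ , col-x , far-row | y , y∈ , row-y , far-col with proj-intersecting x∈ y∈
  ...   | inj₁ near-cols = far-col (subst (λ i → Near k i (col y)) col-x near-cols)
  ...   | inj₂ near-rows = far-row (near-sym {x = row x} (s≤s z≤n) (subst (Near ℓ (row x)) row-y near-rows))

  projIntersecting-bound :
    length xs ≤ n₁ * ℓ ⊎ length xs ≤ n₁ * ℓ′ + (k + k′) * (ℓ + ℓ′) ⊎
    length xs ≤ n₂ * k ⊎ length xs ≤ n₂ * k′ + (ℓ + ℓ′) * (k + k′)
  projIntersecting-bound with ByColumns.bounded-or-splitColumn | ByRows.bounded-or-splitColumn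
  ... | inj₁ bounded | _            = inj₁ bounded
  ... | inj₂ _       | inj₁ bounded = inj₂ (inj₂ (inj₁ bounded))
  ... | inj₂ splitC  | inj₂ splitR
    with ByColumns.bounded-or-crowdedColumn splitC (row (ByRows.SplitColumn.y splitR))
       | ByRows.bounded-or-crowdedColumn splitR (col (ByColumns.SplitColumn.y splitC))
  ...   | inj₁ bounded | _            = inj₂ (inj₁ bounded)
  ...   | inj₂ _       | inj₁ bounded = inj₂ (inj₂ (inj₂ bounded))
  ...   | inj₂ (i₁ , near-i , crowded-i) | inj₂ (j₁ , near-j , crowded-j) = ⊥-elim
    (crowded-columns-and-rows-clash (col (ByColumns.SplitColumn.y splitC)) i₁ (row (ByRows.SplitColumn.y splitR)) j₁
      near-i near-j crowded-i crowded-j)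

cyclic-decomposition : ∀ k′ b n → suc k′ ≤ b → 2 * (suc k′ + b) < n → Σ ℕ λ M → suc k′ + M + k′ ≡ n × k′ + k′ < M
cyclic-decomposition k′ b n k≤b room = M , n≡ , k′+k′<M
  where
  S = suc k′ + k′
  S+k′+k′<n : S + (k′ + k′) < n
  S+k′+k′<n = ≤-<-trans (begin
    S + (k′ + k′)                   ≤⟨ m≤m+n _ 3 ⟩
    suc k′ + k′ + (k′ + k′) + 3     ≡⟨ solve (k′ ∷ []) ⟩
    2 * (suc k′ + suc k′)           ≤⟨ *-monoʳ-≤ 2 (+-monoʳ-≤ (suc k′) k≤b) ⟩
    2 * (suc k′ + b)                ∎) room
    where open ≤-Reasoning
  M = n ∸ S
  S+M≡n : S + M ≡ n
  S+M≡n = m+[n∸m]≡n (≤-trans (m≤m+n S _) (<⇒≤ S+k′+k′<n))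
  n≡ : suc k′ + M + k′ ≡ n
  n≡ = trans (rearrange k′ M) S+M≡n
    where
    rearrange : ∀ k′ M → suc k′ + M + k′ ≡ suc k′ + k′ + M
    rearrange = solve-∀
  k′+k′<M : k′ + k′ < M
  k′+k′<M = +-cancelˡ-< S (k′ + k′) M (subst (S + (k′ + k′) <_) (sym S+M≡n) S+k′+k′<n)

mixed-bound : ∀ {k′ ℓ′ b} n → suc k′ ≤ b → suc ℓ′ ≤ b → n * ℓ′ + (suc k′ + k′) * (suc ℓ′ + ℓ′) ≤ 4 * (b * b) + ℓ′ * n
mixed-bound {k′} {ℓ′} {b} n k≤b ℓ≤b = begin
  n * ℓ′ + (suc k′ + k′) * (suc ℓ′ + ℓ′) ≤⟨ +-monoʳ-≤ (n * ℓ′) (*-mono-≤ (+-mono-≤ k≤b (≤-trans (n≤1+n k′) k≤b))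
                                                                      (+-mono-≤ ℓ≤b (≤-trans (n≤1+n ℓ′) ℓ≤b))) ⟩
  n * ℓ′ + (b + b) * (b + b)            ≡⟨ solve (n ∷ ℓ′ ∷ b ∷ []) ⟩
  4 * (b * b) + ℓ′ * n                  ∎
  where open ≤-Reasoning

projIntersectingFamily⇒near : ∀ {n₁ n₂} .{{_ : NonZero n₁}} .{{_ : NonZero n₂}} {k ℓ} {R : List (Rect n₁ n₂)} →
  k < n₁ → ℓ < n₂ → ProjIntersectingFamily n₁ n₂ k ℓ R →
  ∀ {r s} → r ∈ R → s ∈ R → Near k (proj₁ r) (proj₁ s) ⊎ Near ℓ (proj₂ r) (proj₂ s)
projIntersectingFamily⇒near k<n₁ ℓ<n₂ family {r} {s} r∈ s∈ with family r∈ s∈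
... | inj₁ meet = inj₁ (intervalsMeet⇒near (proj₁ r) (proj₁ s) k<n₁ meet)
... | inj₂ meet = inj₂ (intervalsMeet⇒near (proj₂ r) (proj₂ s) ℓ<n₂ meet)

corollary2 : (k ℓ b n₁ n₂ : ℕ) → 0 < k → 0 < ℓ → 0 < b →
    .{{_ : NonZero n₁}} → .{{_ : NonZero n₂}} →
    k ≤ b → ℓ ≤ b → 2 * (k + b) < n₁ → 2 * (ℓ + b) < n₂ →
    (R : List (Rect n₁ n₂)) → Unique R → ProjIntersectingFamily n₁ n₂ k ℓ R →
    length R < 9 * (b * b)
      ⊎ length R ≤ 4 * (b * b) + (ℓ ∸ 1) * n₁
      ⊎ length R ≤ ℓ * n₁
      ⊎ length R ≤ 4 * (b * b) + (k ∸ 1) * n₂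
      ⊎ length R ≤ k * n₂
corollary2 (suc k′) (suc ℓ′) b n₁ n₂ _ _ _ k≤b ℓ≤b k-room ℓ-room R uniq family
  with cyclic-decomposition k′ b n₁ k≤b k-room | cyclic-decomposition ℓ′ b n₂ ℓ≤b ℓ-room
... | M₁ , refl , k′+k′<M₁ | M₂ , refl , ℓ′+ℓ′<M₂
  with projIntersecting-bound k′ ℓ′ M₁ M₂ k′+k′<M₁ ℓ′+ℓ′<M₂ proj₁ proj₂ R uniq (λ _ _ → cong₂ _,_)
         (projIntersectingFamily⇒near (fits k-room) (fits ℓ-room) family)
  where
  fits : ∀ {a b n} → 2 * (a + b) < n → a < n
  fits {a} {b} room = ≤-<-trans (≤-trans (m≤m+n a b) (m≤m+n (a + b) _)) room
... | inj₁ bound                 = inj₂ (inj₂ (inj₁ (≤-trans bound (≤-reflexive (*-comm n₁ (suc ℓ′))))))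
... | inj₂ (inj₁ bound)          = inj₂ (inj₁ (≤-trans bound (mixed-bound n₁ k≤b ℓ≤b)))
... | inj₂ (inj₂ (inj₁ bound))   = inj₂ (inj₂ (inj₂ (inj₂ (≤-trans bound (≤-reflexive (*-comm n₂ (suc k′)))))))
... | inj₂ (inj₂ (inj₂ bound))   = inj₂ (inj₂ (inj₂ (inj₁ (≤-trans bound (mixed-bound n₂ ℓ≤b k≤b)))))
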